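{- Let $G$ be a graph, $a,b \in V(G)$, $k$ an integer, and let $C \subseteq V(G)$ and $X \subseteq N(C)$ be vertex sets with $a \in C$ and $G[C]$ connected. Let $\Delta(G,k,C,X)$ denote the set of minimal $a,b$-separators $S$ of $G$ such that $S \subseteq V(G)\setminus C$, $X \subseteq S$, and $|S| \le k$. Then $\Delta(G,k,C,X)$ is nonempty if and only if there is an important $\{b\},C$-separator $S$ of $G$ such that $X \subseteq S$ and $|S| \le k$.
   Context: Graphs are finite, simple and undirected. $N(v)$ is the set of neighbors of $v$; for a vertex set $Y$, $N(Y) = \bigcup_{v \in Y} N(v)\setminus Y$. $G[Y]$ is the induced subgraph on $Y$ and $G\setminus S = G[V(G)\setminus S]$. A minimal $a,b$-separator is a vertex set $S$ such that $a$ and $b$ lie in different connected components of $G\setminus S$, inclusion-wise minimal with this property. For vertex sets $A,B \subseteq V(G)$, a set $S$ is a minimal $A,B$-separator if there exist connected components $C_A, C_B$ of $G\setminus S$ (vertex sets) with $A \subseteq C_A$, $B \subseteq C_B$, and $S = N(C_A) = N(C_B)$. A minimal $A,B$-separator $S$ (with component $C_A$ containing $A$) is an important $A,B$-separator if there is no minimal $A,B$-separator $S'$ with $|S'| \le |S|$ and $C_A \subsetneq C'_A$, where $C'_A$ is the component of $G\setminus S'$ containing $A$. -}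

module Defs where

open import Data.Nat using (ℕ)
open import Data.Bool using (Bool; true; false)
open import Data.Fin using (Fin)
open import Data.Fin.Subset public using (Subset; _∈_; _∉_; _⊆_; _⊂_; ⁅_⁆; ∁; ∣_∣)
open import Data.Product using (Σ; ∃; _×_; _,_)
open import Relation.Binary.PropositionalEquality using (_≡_; _≢_)
open import Relation.Nullary using (¬_)
open import Function.Bundles using (_⇔_)

record Graph (n : ℕ) : Set where
  field
    adj     : Fin n → Fin n → Bool
    adj-sym : ∀ u v → adj u v ≡ adj v u
    irrefl  : ∀ v → adj v v ≡ false

module _ {n : ℕ} (G : Graph n) where
  open Graph G

  Adj : Fin n → Fin n → Set
  Adj u v = adj u v ≡ true

  data Reach (S : Subset n) (u : Fin n) : Fin n → Set where
    here : u ∉ S → Reach S u u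
    step : ∀ {w v} → Reach S u w → Adj w v → v ∉ S → Reach S u v

  IsComponent : Subset n → Subset n → Set
  IsComponent S K = ∃ λ v → v ∈ K × (∀ w → (w ∈ K ⇔ Reach S v w))

  InN : Subset n → Fin n → Set
  InN Y x = x ∉ Y × ∃ λ y → y ∈ Y × Adj x y

  IsNbhd : Subset n → Subset n → Set
  IsNbhd S Y = ∀ x → (x ∈ S ⇔ InN Y x)

  Connected : Subset n → Set
  Connected C = ∀ u v → u ∈ C → v ∈ C → Reach (∁ C) u v

  Separates : Fin n → Fin n → Subset n → Set
  Separates a b S = a ∉ S × b ∉ S × ¬ Reach S a b

  MinSep : Fin n → Fin n → Subset n → Set
  MinSep a b S = Separates a b S × (∀ S' → S' ⊂ S → ¬ Separates a b S')

  MinABSep : Subset n → Subset n → Subset n → Subset n → Set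
  MinABSep A B S CA =
    IsComponent S CA × A ⊆ CA × IsNbhd S CA ×
    ∃ λ CB → IsComponent S CB × B ⊆ CB × IsNbhd S CB × CA ≢ CB

  Important : Subset n → Subset n → Subset n → Subset n → Set
  Important A B S CA =
    MinABSep A B S CA ×
    (∀ S' CA' → MinABSep A B S' CA' → ∣ S' ∣ Data.Nat.≤ ∣ S ∣ → ¬ (CA ⊂ CA'))

-- A minimal a,b-separator S avoiding C splits off the component K of b, and
-- S = N(K); since G[C] is connected and a ∈ C, the component of a contains C,
-- so S is a minimal {b},C-separator. Among the minimal {b},C-separators of size
-- at most |S| whose b-side contains K, one with the largest b-side is important.
-- It still contains X: each x ∈ X is adjacent to K (as x ∈ S = N(K)) and to C,
-- so x cannot lie outside the new separator without merging its two sides.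
-- Conversely, in a minimal {b},C-separator every vertex sees both full
-- components, so it is a minimal a,b-separator, and it avoids C.
module Submission where

open import Defs
open import Data.Nat using (ℕ; zero; suc; _<_; _+_) renaming (_≤_ to _≤ℕ_; _≤?_ to _≤ℕ?_; _<?_ to _<ℕ?_)
open import Data.Nat.Properties
  using (≤-refl; ≤-reflexive; ≤-trans; ≤-pred; <-≤-trans; ≤-<-trans; <⇒≱; ≮⇒≥; n≮0; m≤m+n; +-suc; +-monoʳ-≤)
open import Data.Integer using (ℤ; +_; _≤_; +≤+)
import Data.Integer.Properties as ℤ
open import Data.Fin using (Fin; _≟_)
open import Data.Fin.Subset using (_∪_; _-_)
open import Data.Fin.Subset.Properties
  using (_∈?_; _⊆?_; ⊆-trans; ⊆-antisym; p⊂q⇒∣p∣<∣q∣; p⊂q⇒∁p⊃∁q; p⊆p∪q; x∈p∪q⁻; x∈p∪q⁺; x∈⁅x⁆;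
         x∈⁅y⁆⇒x≡y; x≢y⇒x∉⁅y⁆; x∉p⇒x∈∁p; x∈p∧x≢y⇒x∈p-y; x∈p⇒p-x⊂p; p─q⊆p; anySubset?; ∣p∣≤n)
open import Data.Fin.Properties using (any?; all?)
open import Data.Bool using (true)
import Data.Bool as Bool
open import Data.Vec using (tabulate)
open import Data.Vec.Properties using (lookup∘tabulate; []=⇒lookup; lookup⇒[]=; ≡-dec)
open import Data.Product using (∃; ∃₂; _×_; _,_; proj₁)
open import Data.Sum using (_⊎_; inj₁; inj₂; [_,_])
open import Data.Empty using (⊥-elim)
open import Function using (_∘_; id)
open import Relation.Nullary using (¬_; Dec; yes; no; does)
open import Relation.Nullary.Decidable using (_×-dec_; _→-dec_; ¬?; map′; dec-true)
open import Relation.Binary.PropositionalEquality using (_≡_; _≢_; refl; sym; trans; subst)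
open import Function.Bundles using (_⇔_; mk⇔; Equivalence)

open Equivalence using (to; from)

_⇔-dec_ : {A B : Set} → Dec A → Dec B → Dec (A ⇔ B)
a? ⇔-dec b? = map′ (λ (f , g) → mk⇔ f g) (λ e → to e , from e) ((a? →-dec b?) ×-dec (b? →-dec a?))

does≡true⇒ : {A : Set} (a? : Dec A) → does a? ≡ true → A
does≡true⇒ (yes a) _ = a

∈-tabulate-does : ∀ {n} {P : Fin n → Set} (P? : ∀ w → Dec (P w)) w →
                  w ∈ tabulate (does ∘ P?) ⇔ P w
∈-tabulate-does P? w = mk⇔
  (λ w∈ → does≡true⇒ (P? w) (trans (sym (lookup∘tabulate _ w)) ([]=⇒lookup w∈)))
  (λ p → lookup⇒[]= w _ (trans (lookup∘tabulate _ w) (dec-true (P? w) p)))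

∉-∪-⁅⁆ : ∀ {n} {S : Subset n} {x u} → x ∉ S → x ≢ u → x ∉ S ∪ ⁅ u ⁆
∉-∪-⁅⁆ {S = S} {u = u} x∉S x≢u x∈ = [ x∉S , x≢y⇒x∉⁅y⁆ x≢u ] (x∈p∪q⁻ S ⁅ u ⁆ x∈)

∣∁∪⁅⁆∣< : ∀ {n} (S : Subset n) {u} → u ∉ S → ∣ ∁ (S ∪ ⁅ u ⁆) ∣ < ∣ ∁ S ∣
∣∁∪⁅⁆∣< S {u} u∉S = p⊂q⇒∣p∣<∣q∣ (p⊂q⇒∁p⊃∁q (p⊆p∪q ⁅ u ⁆ , u , x∈p∪q⁺ (inj₂ (x∈⁅x⁆ u)) , u∉S))

∃-largest-second : ∀ {n} (P : Subset n → Subset n → Set) → (∀ S C → Dec (P S C)) →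
                   ∀ {S C} → P S C → ∃₂ λ S* C* → P S* C* × (∀ S' C' → P S' C' → ∣ C' ∣ ≤ℕ ∣ C* ∣)
∃-largest-second {n} P P? {C = C} = search n (m≤m+n n ∣ C ∣)
  where
  search : ∀ fuel {S C} → n ≤ℕ fuel + ∣ C ∣ → P S C →
           ∃₂ λ S* C* → P S* C* × (∀ S' C' → P S' C' → ∣ C' ∣ ≤ℕ ∣ C* ∣)
  search fuel {S} {C} bound pSC
    with anySubset? (λ S' → anySubset? (λ C' → P? S' C' ×-dec (∣ C ∣ <ℕ? ∣ C' ∣)))
  ... | no ¬larger = S , C , pSC , λ S' C' pS'C' → ≮⇒≥ (λ lt → ¬larger (S' , C' , pS'C' , lt))
  search zero bound _ | yes (_ , C' , _ , lt) = ⊥-elim (<⇒≱ (≤-<-trans bound lt) (∣p∣≤n C'))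
  search (suc fuel) {C = C} bound _ | yes (_ , _ , pS'C' , lt) =
    search fuel (≤-trans bound (≤-trans (≤-reflexive (sym (+-suc fuel ∣ C ∣))) (+-monoʳ-≤ fuel lt))) pS'C'

module Separators {n : ℕ} (G : Graph n) where
  open Graph G

  Adj-sym : ∀ {u v} → Adj G u v → Adj G v u
  Adj-sym {u} {v} = trans (adj-sym v u)

  Adj? : ∀ u v → Dec (Adj G u v)
  Adj? u v = adj u v Bool.≟ true

  reach-start : ∀ {S u v} → Reach G S u v → u ∉ S
  reach-start (here u∉S) = u∉S
  reach-start (step r _ _) = reach-start r

  reach-end : ∀ {S u v} → Reach G S u v → v ∉ S
  reach-end (here v∉S) = v∉S
  reach-end (step _ _ v∉S) = v∉S

  reach-trans : ∀ {S u w v} → Reach G S u w → Reach G S w v → Reach G S u v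
  reach-trans r (here _) = r
  reach-trans r (step r' e v∉S) = step (reach-trans r r') e v∉S

  reach-sym : ∀ {S u v} → Reach G S u v → Reach G S v u
  reach-sym (here u∉S) = here u∉S
  reach-sym (step r e v∉S) = reach-trans (step (here v∉S) (Adj-sym e) (reach-end r)) (reach-sym r)

  reach-mono : ∀ {S S'} → S' ⊆ S → ∀ {u v} → Reach G S u v → Reach G S' u v
  reach-mono S'⊆S (here u∉S) = here (u∉S ∘ S'⊆S)
  reach-mono S'⊆S (step r e v∉S) = step (reach-mono S'⊆S r) e (v∉S ∘ S'⊆S)

  reach-first-step : ∀ {S u v} → Reach G S u v → u ≢ v → ∃ λ w → Adj G u w × Reach G (S ∪ ⁅ u ⁆) w v
  reach-first-step (here _) u≢v = ⊥-elim (u≢v refl)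
  reach-first-step {u = u} (step {w} {v} r e v∉S) u≢v with w ≟ u
  ... | yes refl = v , e , here (∉-∪-⁅⁆ v∉S (u≢v ∘ sym))
  ... | no w≢u with reach-first-step r (w≢u ∘ sym)
  ...   | w' , e' , r' = w' , e' , step r' e (∉-∪-⁅⁆ v∉S (u≢v ∘ sym))

  -- The fuel bounds the number of vertices outside S; each first step blocks one more.
  reach?-within : ∀ fuel S → ∣ ∁ S ∣ ≤ℕ fuel → ∀ u v → Dec (Reach G S u v)
  reach?-within fuel S bound u v with u ∈? S | u ≟ v
  ... | yes u∈S | _ = no λ r → reach-start r u∈S
  ... | no u∉S | yes refl = yes (here u∉S)
  reach?-within zero S bound u v | no u∉S | no _ = ⊥-elim (n≮0 (<-≤-trans (∣∁∪⁅⁆∣< S u∉S) bound))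
  reach?-within (suc fuel) S bound u v | no u∉S | no u≢v =
    map′ (λ (w , e , r) → reach-trans (step (here u∉S) e (reach-start r ∘ x∈p∪q⁺ ∘ inj₁))
                                      (reach-mono (p⊆p∪q ⁅ u ⁆) r))
         (λ r → reach-first-step r u≢v)
         (any? λ w → Adj? u w ×-dec
            reach?-within fuel (S ∪ ⁅ u ⁆) (≤-pred (<-≤-trans (∣∁∪⁅⁆∣< S u∉S) bound)) w v)

  reach? : ∀ S u v → Dec (Reach G S u v)
  reach? S = reach?-within _ S ≤-refl

  reach-unblock : ∀ {S x u v} → x ∈ S → u ∉ S → Reach G (S - x) u v →
                  Reach G S u v ⊎ ∃ λ y → Reach G S u y × Adj G y x
  reach-unblock x∈S u∉S (here _) = inj₁ (here u∉S)
  reach-unblock {x = x} x∈S u∉S (step {w} {v} r e v∉S-x) with reach-unblock x∈S u∉S r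
  ... | inj₂ y = inj₂ y
  ... | inj₁ r' with v ≟ x
  ...   | yes refl = inj₂ (w , r' , e)
  ...   | no v≢x = inj₁ (step r' e (v∉S-x ∘ λ v∈S → x∈p∧x≢y⇒x∈p-y v∈S v≢x))

  IsComponent⇒Reach : ∀ {S K x y} → IsComponent G S K → x ∈ K → y ∈ K → Reach G S x y
  IsComponent⇒Reach (_ , _ , K⇔) x∈K y∈K = reach-trans (reach-sym (to (K⇔ _) x∈K)) (to (K⇔ _) y∈K)

  IsComponent-closed : ∀ {S K x y} → IsComponent G S K → x ∈ K → Reach G S x y → y ∈ K
  IsComponent-closed (_ , _ , K⇔) x∈K r = from (K⇔ _) (reach-trans (to (K⇔ _) x∈K) r)

  IsComponent⇒∉ : ∀ {S K x} → IsComponent G S K → x ∈ K → x ∉ S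
  IsComponent⇒∉ (_ , _ , K⇔) x∈K = reach-end (to (K⇔ _) x∈K)

  IsComponent-unique : ∀ {S K K' x} → IsComponent G S K → IsComponent G S K' → x ∈ K → x ∈ K' → K ≡ K'
  IsComponent-unique c c' x∈K x∈K' =
    ⊆-antisym (IsComponent-closed c' x∈K' ∘ IsComponent⇒Reach c x∈K)
              (IsComponent-closed c x∈K ∘ IsComponent⇒Reach c' x∈K')

  component : Subset n → Fin n → Subset n
  component S u = tabulate (does ∘ reach? S u)

  ∈component⇔Reach : ∀ S u {w} → w ∈ component S u ⇔ Reach G S u w
  ∈component⇔Reach S u {w} = ∈-tabulate-does (reach? S u) w

  component-isComponent : ∀ {S u} → u ∉ S → IsComponent G S (component S u)
  component-isComponent {S} {u} u∉S =
    u , from (∈component⇔Reach S u) (here u∉S) , λ _ → ∈component⇔Reach S u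

  component-full : ∀ {S u t} → u ∉ S → ¬ Reach G S u t → (∀ {x} → x ∈ S → Reach G (S - x) u t) →
                   IsNbhd G S (component S u)
  component-full {S} {u} u∉S ¬u⇝t unblocked x = mk⇔ into-N out-of-N
    where
    K⇒Reach : ∀ {w} → w ∈ component S u → Reach G S u w
    K⇒Reach = to (∈component⇔Reach S u)
    Reach⇒K : ∀ {w} → Reach G S u w → w ∈ component S u
    Reach⇒K = from (∈component⇔Reach S u)
    into-N : x ∈ S → InN G (component S u) x
    into-N x∈S with reach-unblock x∈S u∉S (unblocked x∈S)
    ... | inj₁ u⇝t = ⊥-elim (¬u⇝t u⇝t)
    ... | inj₂ (y , u⇝y , y~x) =
      (λ x∈K → reach-end (K⇒Reach x∈K) x∈S) , y , Reach⇒K u⇝y , Adj-sym y~x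
    out-of-N : InN G (component S u) x → x ∈ S
    out-of-N (x∉K , y , y∈K , x~y) with x ∈? S
    ... | yes x∈S = x∈S
    ... | no x∉S = ⊥-elim (x∉K (Reach⇒K (step (K⇒Reach y∈K) (Adj-sym x~y) x∉S)))

  isComponent? : ∀ S K → Dec (IsComponent G S K)
  isComponent? S K = any? λ v → (v ∈? K) ×-dec all? λ w → (w ∈? K) ⇔-dec reach? S v w

  inN? : ∀ Y x → Dec (InN G Y x)
  inN? Y x = ¬? (x ∈? Y) ×-dec any? λ y → (y ∈? Y) ×-dec Adj? x y

  isNbhd? : ∀ S Y → Dec (IsNbhd G S Y)
  isNbhd? S Y = all? λ x → (x ∈? S) ⇔-dec inN? Y x

  minABSep? : ∀ A B S CA → Dec (MinABSep G A B S CA)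
  minABSep? A B S CA = isComponent? S CA ×-dec (A ⊆? CA) ×-dec isNbhd? S CA ×-dec
    anySubset? λ CB → isComponent? S CB ×-dec (B ⊆? CB) ×-dec isNbhd? S CB ×-dec
                      ¬? (≡-dec Bool._≟_ CA CB)

  minSep-unblock : ∀ {a b S x} → MinSep G a b S → x ∈ S → Reach G (S - x) a b
  minSep-unblock {a} {b} {S} {x} ((a∉S , b∉S , _) , minimal) x∈S with reach? (S - x) a b
  ... | yes a⇝b = a⇝b
  ... | no ¬a⇝b = ⊥-elim (minimal (S - x) (x∈p⇒p-x⊂p x∈S)
                           (a∉S ∘ p─q⊆p S ⁅ x ⁆ , b∉S ∘ p─q⊆p S ⁅ x ⁆ , ¬a⇝b))

  minSep⇒minABSep : ∀ {a b S C} → MinSep G a b S → a ∈ C → Connected G C → (∀ x → x ∈ S → x ∉ C) →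
                    MinABSep G ⁅ b ⁆ C S (component S b)
  minSep⇒minABSep {a} {b} {S} minSep@((a∉S , b∉S , ¬a⇝b) , _) a∈C C-connected S∩C≡∅ =
    component-isComponent b∉S ,
    (λ x∈⁅b⁆ → subst (_∈ component S b) (sym (x∈⁅y⁆⇒x≡y b x∈⁅b⁆)) b∈Kb) ,
    component-full b∉S (¬a⇝b ∘ reach-sym) (reach-sym ∘ minSep-unblock minSep) ,
    component S a , component-isComponent a∉S ,
    (λ c∈C → from (∈component⇔Reach S a)
               (reach-mono (λ {x} x∈S → x∉p⇒x∈∁p (S∩C≡∅ x x∈S)) (C-connected a _ a∈C c∈C))) ,
    component-full a∉S ¬a⇝b (minSep-unblock minSep) ,
    λ Kb≡Ka → ¬a⇝b (to (∈component⇔Reach S a) (subst (b ∈_) Kb≡Ka b∈Kb))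
    where
    b∈Kb : b ∈ component S b
    b∈Kb = from (∈component⇔Reach S b) (here b∉S)

  minABSep⇒minSep : ∀ {A B S CA a b} → MinABSep G A B S CA → b ∈ A → a ∈ B → MinSep G a b S
  minABSep⇒minSep {S = S} (compCA , A⊆CA , nbCA , CB , compCB , B⊆CB , nbCB , CA≢CB) b∈A a∈B =
    (IsComponent⇒∉ compCB a∈CB , IsComponent⇒∉ compCA b∈CA ,
     λ a⇝b → CA≢CB (IsComponent-unique compCA compCB b∈CA (IsComponent-closed compCB a∈CB a⇝b))) ,
    minimal
    where
    a∈CB = B⊆CB a∈B
    b∈CA = A⊆CA b∈A
    minimal : ∀ S' → S' ⊂ S → ¬ Separates G _ _ S'
    minimal S' (S'⊆S , s , s∈S , s∉S') (_ , _ , ¬a⇝b) with to (nbCA s) s∈S | to (nbCB s) s∈S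
    ... | _ , y , y∈CA , s~y | _ , z , z∈CB , s~z =
      ¬a⇝b (reach-trans (step (step a⇝z (Adj-sym s~z) s∉S') s~y (reach-start y⇝b)) y⇝b)
      where
      a⇝z = reach-mono S'⊆S (IsComponent⇒Reach compCB a∈CB z∈CB)
      y⇝b = reach-mono S'⊆S (IsComponent⇒Reach compCA y∈CA b∈CA)

  minABSep-avoids-B : ∀ {A B S CA x} → MinABSep G A B S CA → x ∈ B → x ∉ S
  minABSep-avoids-B (_ , _ , _ , _ , compCB , B⊆CB , _) = IsComponent⇒∉ compCB ∘ B⊆CB

  minABSep-common-neighbour : ∀ {A B S CA x y z} → MinABSep G A B S CA →
                              Adj G x y → y ∈ CA → Adj G x z → z ∈ B → x ∈ S
  minABSep-common-neighbour {x = x} (compCA , _ , _ , CB , compCB , B⊆CB , nbCB , CA≢CB)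
                            x~y y∈CA x~z z∈B =
    from (nbCB x) (x∉CB , _ , B⊆CB z∈B , x~z)
    where
    x∉CB : x ∉ CB
    x∉CB x∈CB = CA≢CB (IsComponent-unique compCA compCB x∈CA x∈CB)
      where
      y⇝x = step (here (IsComponent⇒∉ compCA y∈CA)) (Adj-sym x~y) (IsComponent⇒∉ compCB x∈CB)
      x∈CA = IsComponent-closed compCA y∈CA y⇝x

  minABSep⇒important : ∀ {A B S K} → MinABSep G A B S K →
                       ∃₂ λ S* K* → Important G A B S* K* × ∣ S* ∣ ≤ℕ ∣ S ∣ × K ⊆ K*
  minABSep⇒important {A} {B} {S} {K} minABSep =
    important-of-largest (∃-largest-second Dominated Dominated? (minABSep , ≤-refl , id))
    where
    Dominated : Subset n → Subset n → Set
    Dominated S' K' = MinABSep G A B S' K' × ∣ S' ∣ ≤ℕ ∣ S ∣ × K ⊆ K'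
    Dominated? : ∀ S' K' → Dec (Dominated S' K')
    Dominated? S' K' = minABSep? A B S' K' ×-dec (∣ S' ∣ ≤ℕ? ∣ S ∣) ×-dec (K ⊆? K')
    important-of-largest : (∃₂ λ S* K* → Dominated S* K* × (∀ S' K' → Dominated S' K' → ∣ K' ∣ ≤ℕ ∣ K* ∣)) →
                           ∃₂ λ S* K* → Important G A B S* K* × ∣ S* ∣ ≤ℕ ∣ S ∣ × K ⊆ K*
    important-of-largest (S* , K* , (minABSep* , ∣S*∣≤∣S∣ , K⊆K*) , largest) =
      S* , K* , (minABSep* , no-larger) , ∣S*∣≤∣S∣ , K⊆K*
      where
      no-larger : ∀ S' K' → MinABSep G A B S' K' → ∣ S' ∣ ≤ℕ ∣ S* ∣ → ¬ (K* ⊂ K')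
      no-larger S' K' minABSep' ∣S'∣≤∣S*∣ K*⊂K' =
        <⇒≱ (p⊂q⇒∣p∣<∣q∣ K*⊂K')
            (largest S' K' (minABSep' , ≤-trans ∣S'∣≤∣S*∣ ∣S*∣≤∣S∣ , ⊆-trans K⊆K* (proj₁ K*⊂K')))

lemma1 : {n : ℕ} (G : Graph n) (a b : Fin n) (k : ℤ) (C X : Subset n) →
    (∀ x → x ∈ X → InN G C x) → a ∈ C → Connected G C →
    (∃ λ S → MinSep G a b S × (∀ x → x ∈ S → x ∉ C) × X ⊆ S × (+ ∣ S ∣) ≤ k)
    ⇔ (∃ λ S → ∃ λ Cb → Important G ⁅ b ⁆ C S Cb × X ⊆ S × (+ ∣ S ∣) ≤ k)
lemma1 G a b k C X X⊆N[C] a∈C C-connected = mk⇔ to-important from-important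
  where
  open Separators G

  to-important : (∃ λ S → MinSep G a b S × (∀ x → x ∈ S → x ∉ C) × X ⊆ S × (+ ∣ S ∣) ≤ k) →
                 ∃ λ S → ∃ λ Cb → Important G ⁅ b ⁆ C S Cb × X ⊆ S × (+ ∣ S ∣) ≤ k
  to-important (S , minSep , S∩C≡∅ , X⊆S , ∣S∣≤k)
    with minSep⇒minABSep minSep a∈C C-connected S∩C≡∅
  ... | minABSep@(_ , _ , nbKb , _)
    with minABSep⇒important minABSep
  ... | S* , K* , important , ∣S*∣≤∣S∣ , Kb⊆K* =
    S* , K* , important , X⊆S* , ℤ.≤-trans (+≤+ ∣S*∣≤∣S∣) ∣S∣≤k
    where
    X⊆S* : X ⊆ S*
    X⊆S* {x} x∈X with X⊆N[C] x x∈X | to (nbKb x) (X⊆S x∈X)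
    ... | _ , c , c∈C , x~c | _ , y , y∈Kb , x~y =
      minABSep-common-neighbour (proj₁ important) x~y (Kb⊆K* y∈Kb) x~c c∈C

  from-important : (∃ λ S → ∃ λ Cb → Important G ⁅ b ⁆ C S Cb × X ⊆ S × (+ ∣ S ∣) ≤ k) →
                   ∃ λ S → MinSep G a b S × (∀ x → x ∈ S → x ∉ C) × X ⊆ S × (+ ∣ S ∣) ≤ k
  from-important (S , Cb , (minABSep , _) , X⊆S , ∣S∣≤k) =
    S , minABSep⇒minSep minABSep (x∈⁅x⁆ b) a∈C ,
    (λ x x∈S x∈C → minABSep-avoids-B minABSep x∈C x∈S) , X⊆S , ∣S∣≤k
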